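{- For $n\ge 1$ let $a_n = |S_n^2(132,213,321)|$. Then $a_{n} = n^2$ for all $n\ge 1$.
   Context: A $3$-permutation of size $n$ is an ordered pair $(\sigma,\sigma')$ of permutations of $[n]=\{1,\dots,n\}$. A (classical) permutation $\tau\in S_n$ contains a pattern $\pi\in S_k$ if there are indices $c_1<\dots<c_k$ such that $\tau(c_1)\cdots\tau(c_k)$ is order-isomorphic to $\pi$, and avoids $\pi$ otherwise. A $3$-permutation $(\sigma,\sigma')$ avoids a pattern $\pi\in S_k$ if each of the three permutations $\sigma$, $\sigma'$, and $\sigma'\circ\sigma^{ -1}$ (where $(\sigma'\circ\sigma^{ -1})(i)=\sigma'(\sigma^{ -1}(i))$) avoids $\pi$. $S_n^2(\pi_1,\dots,\pi_m)$ denotes the set of $3$-permutations of size $n$ avoiding each of $\pi_1,\dots,\pi_m$. Patterns are written in one-line notation. -}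

module Defs where

open import Data.Nat using (ℕ; zero; suc)
open import Data.Fin using (Fin; zero; suc; _<_; _<?_)
open import Data.Fin.Properties using (_≟_)
open import Data.Maybe using (Maybe; just; nothing; fromMaybe)
open import Data.Vec using (Vec; []; _∷_; lookup; toList; tabulate)
open import Data.List using (List; []; _∷_; concatMap; map; length; filter; allFin)
open import Data.List.Relation.Unary.Unique.Propositional using (Unique)
import Data.List.Relation.Unary.Unique.DecPropositional as UDec
open import Data.Product using (_×_; _,_; Σ; ∃)
open import Function.Bundles using (_⇔_)
open import Relation.Nullary using (Dec; yes; no; ¬_)
open import Relation.Unary using (Decidable)
open import Data.List.Membership.Propositional using (_∈_)
open import Relation.Binary.PropositionalEquality using (_≡_)

-- A permutation of [n] in one-line notation: a length-n vector with entries
-- in Fin n (0..n-1 standing for 1..n) that are pairwise distinct.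
IsPerm : {n : ℕ} → Vec (Fin n) n → Set
IsPerm v = Unique (toList v)

isPerm? : {n : ℕ} → Decidable (IsPerm {n})
isPerm? {n} v = UDec.unique? (_≟_ {n}) (toList v)

Contains : {k n : ℕ} → Vec (Fin k) k → Vec (Fin n) n → Set
Contains {k} {n} π τ =
  Σ (Fin k → Fin n) λ c →
    (∀ i j → i < j → c i < c j) ×
    (∀ i j → (lookup τ (c i) < lookup τ (c j)) ⇔ (lookup π i < lookup π j))

Avoids : {k n : ℕ} → Vec (Fin k) k → Vec (Fin n) n → Set
Avoids π τ = ¬ Contains π τ

position : {n m : ℕ} → Vec (Fin n) m → Fin n → Maybe (Fin m)
position [] x = nothing
position (a ∷ v) x with a ≟ x
... | yes _ = just zero
... | no _ = Data.Maybe.map suc (position v x)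
  where import Data.Maybe

-- Inverse of a permutation σ in one-line notation: σ⁻¹(i) = the j with σ(j) = i.
-- (The fallback value i is never used when σ is a permutation.)
inverse : {n : ℕ} → Vec (Fin n) n → Vec (Fin n) n
inverse σ = tabulate (λ i → fromMaybe i (position σ i))

compose∘inv : {n : ℕ} → Vec (Fin n) n → Vec (Fin n) n → Vec (Fin n) n
compose∘inv σ' σ = tabulate (λ i → lookup σ' (lookup (inverse σ) i))

Avoids3 : {k n : ℕ} → Vec (Fin k) k → Vec (Fin n) n × Vec (Fin n) n → Set
Avoids3 π (σ , σ') = Avoids π σ × Avoids π σ' × Avoids π (compose∘inv σ' σ)

-- Membership in S_n^2(132, 213, 321) (patterns written 0-based: 132 ↦ 021 etc.).
p132 p213 p321 : Vec (Fin 3) 3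
p132 = zero ∷ suc (suc zero) ∷ suc zero ∷ []
p213 = suc zero ∷ zero ∷ suc (suc zero) ∷ []
p321 = suc (suc zero) ∷ suc zero ∷ zero ∷ []

InS2-132-213-321 : (n : ℕ) → Vec (Fin n) n × Vec (Fin n) n → Set
InS2-132-213-321 n (σ , σ') =
  IsPerm σ × IsPerm σ' ×
  Avoids3 p132 (σ , σ') × Avoids3 p213 (σ , σ') × Avoids3 p321 (σ , σ')

HasCard : {A : Set} → (A → Set) → ℕ → Set
HasCard {A} P m = Σ (List A) λ L → Unique L × (∀ x → (x ∈ L) ⇔ P x) × (length L ≡ m)

{-# OPTIONS --safe #-}
-- A permutation avoiding 132, 213 and 321 is a rotation i ↦ i + s (mod n).  Look at
-- two adjacent entries.  If they ascend, a value strictly between them sits left or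
-- right of the pair and creates a 213 or a 132.  If they descend, a value below them
-- creates a 132 or a 321, and a value above them a 321 or a 213; so the pair is
-- n-1 followed by 0.  Either way each entry is its predecessor plus 1 mod n.
-- Conversely rotations avoid the three patterns, and they form a group, so σ' ∘ σ⁻¹
-- is a rotation whenever σ and σ' are: the 3-permutations are the n² pairs of rotations.
module Submission where

open import Defs
open import Data.Nat using (ℕ; suc; _*_)

open import Data.Nat as ℕ using (_+_; _∸_; _%_; z<s; s<s; NonZero)
open import Data.Nat.Properties as ℕP
  using (≤-trans; ≤-antisym; ≮⇒≥; n≤0⇒n≡0; +-monoˡ-<; m≤n+m; m∸n+n≡m; m∸[m∸n]≡n;
         m≤o∸n⇒m+n≤o; ∸-monoˡ-<; +-assoc; +-comm)
open import Data.Nat.DivMod using (_mod_; %-distribˡ-+; m%n%n≡m%n; [m+n]%n≡m%n; m<n⇒m%n≡m; n%n≡0; m%n<n)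
open import Data.Fin as Fin using (Fin; zero; suc; toℕ; fromℕ<; inject₁; remQuot; combine; _<_)
import Data.Fin.Properties as FinP
open import Data.Fin.Induction using (<-weakInduction)
open import Data.Fin.Patterns using (0F; 1F; 2F)
open import Data.Vec using (Vec; []; _∷_; lookup; toList; tabulate)
open import Data.Vec.Properties using (lookup∘tabulate; tabulate∘lookup; tabulate-cong)
import Data.Vec.Relation.Unary.All.Properties as VecAllP
import Data.Vec.Relation.Unary.Unique.Propositional as VecUnique
import Data.Vec.Relation.Unary.Unique.Propositional.Properties as VecUniqueP
import Data.List as List
open import Data.List.Properties using (length-tabulate)
open import Data.List.Relation.Unary.AllPairs using ([]; _∷_)
open import Data.List.Relation.Unary.Unique.Propositional using (Unique)
open import Data.List.Relation.Unary.Unique.Propositional.Properties using (tabulate⁺)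
open import Data.List.Membership.Propositional using (_∈_)
open import Data.List.Membership.Propositional.Properties using (∈-tabulate⁺; ∈-tabulate⁻)
open import Data.Maybe as Maybe using (just; fromMaybe)
open import Data.Product using (_×_; _,_; ∃; proj₁; proj₂; uncurry)
open import Data.Product.Properties using (×-≡,≡→≡)
open import Data.Sum using (_⊎_; inj₁; inj₂)
open import Data.Empty using (⊥; ⊥-elim)
open import Function using (_∘_)
open import Function.Bundles using (_⇔_; mk⇔; Equivalence)
open import Relation.Nullary using (yes; no; ¬_)
open import Relation.Binary using (tri<; tri≈; tri>)
open import Relation.Binary.PropositionalEquality
  using (_≡_; _≢_; refl; sym; trans; cong; subst; module ≡-Reasoning)

open Equivalence using (to; from)

-- Counting by an injective parametrisation

HasCard-image : ∀ {A : Set} {P : A → Set} {m} (f : Fin m → A) →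
                (∀ {i j} → f i ≡ f j → i ≡ j) → (∀ x → P x ⇔ ∃ λ i → x ≡ f i) →
                HasCard P m
HasCard-image {P = P} f f-inj P⇔image =
  List.tabulate f , tabulate⁺ f-inj , membership , length-tabulate f
  where
  membership : ∀ x → x ∈ List.tabulate f ⇔ P x
  membership x = mk⇔ (from (P⇔image x) ∘ ∈-tabulate⁻)
                     (λ Px → let i , x≡fi = to (P⇔image x) Px in subst (_∈ _) (sym x≡fi) (∈-tabulate⁺ i))

HasCard-image₂ : ∀ {A : Set} {P : A → Set} {m n} (f : Fin m × Fin n → A) →
                 (∀ {i j} → f i ≡ f j → i ≡ j) → (∀ x → P x ⇔ ∃ λ i → x ≡ f i) →
                 HasCard P (m * n)
HasCard-image₂ {m = m} {n} f f-inj P⇔image =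
  HasCard-image (f ∘ remQuot n) remQuot-f-injective
    (λ x → mk⇔ (pairs→indices x ∘ to (P⇔image x)) (from (P⇔image x) ∘ indices→pairs))
  where
  remQuot-f-injective : ∀ {i j} → f (remQuot n i) ≡ f (remQuot n j) → i ≡ j
  remQuot-f-injective {i} {j} e = begin
    i                                 ≡⟨ FinP.combine-remQuot {m} n i ⟨
    uncurry combine (remQuot {m} n i) ≡⟨ cong (uncurry combine) (f-inj e) ⟩
    uncurry combine (remQuot {m} n j) ≡⟨ FinP.combine-remQuot {m} n j ⟩
    j                                 ∎
    where open ≡-Reasoning
  pairs→indices : ∀ x → (∃ λ ij → x ≡ f ij) → ∃ λ i → x ≡ f (remQuot n i)
  pairs→indices x ((i , j) , x≡f) = combine i j , trans x≡f (cong f (sym (FinP.remQuot-combine i j)))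
  indices→pairs : ∀ {x} → (∃ λ i → x ≡ f (remQuot n i)) → ∃ λ ij → x ≡ f ij
  indices→pairs (i , x≡f) = remQuot n i , x≡f

Unique-toList⁻ : ∀ {A : Set} {m} {xs : Vec A m} → Unique (toList xs) → VecUnique.Unique xs
Unique-toList⁻ {xs = []}    _              = VecUnique.[]
Unique-toList⁻ {xs = _ ∷ _} (x∉xs ∷ xs!)  = VecAllP.toList⁻ x∉xs VecUnique.∷ Unique-toList⁻ xs!

Unique-toList⁺ : ∀ {A : Set} {m} {xs : Vec A m} → VecUnique.Unique xs → Unique (toList xs)
Unique-toList⁺ VecUnique.[]            = []
Unique-toList⁺ (x∉xs VecUnique.∷ xs!) = VecAllP.toList⁺ x∉xs ∷ Unique-toList⁺ xs!

isPerm-injective : ∀ {n} {σ : Vec (Fin n) n} → IsPerm σ → ∀ {i j} → lookup σ i ≡ lookup σ j → i ≡ j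
isPerm-injective σ! = VecUniqueP.lookup-injective (Unique-toList⁻ σ!) _ _

injective⇒isPerm : ∀ {n} {σ : Vec (Fin n) n} → (∀ {i j} → lookup σ i ≡ lookup σ j → i ≡ j) → IsPerm σ
injective⇒isPerm {σ = σ} inj = subst IsPerm (tabulate∘lookup σ) (Unique-toList⁺ (VecUniqueP.tabulate⁺ inj))

position-lookup : ∀ {n m} {v : Vec (Fin n) m} → VecUnique.Unique v → ∀ p → position v (lookup v p) ≡ just p
position-lookup {v = a ∷ v} _ zero with a FinP.≟ a
... | yes _   = refl
... | no a≢a  = ⊥-elim (a≢a refl)
position-lookup {v = a ∷ v} (a∉v VecUnique.∷ v!) (suc p) with a FinP.≟ lookup v p
... | yes a≡vp = ⊥-elim (VecAllP.lookup⁺ a∉v p a≡vp)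
... | no _     = cong (Maybe.map suc) (position-lookup v! p)

inverse-lookup : ∀ {n} {σ : Vec (Fin n) n} → IsPerm σ → ∀ p → lookup (inverse σ) (lookup σ p) ≡ p
inverse-lookup {σ = σ} σ! p = begin
  lookup (inverse σ) (lookup σ p)                  ≡⟨ lookup∘tabulate _ (lookup σ p) ⟩
  fromMaybe (lookup σ p) (position σ (lookup σ p)) ≡⟨ cong (fromMaybe _) (position-lookup (Unique-toList⁻ σ!) p) ⟩
  p                                                ∎
  where open ≡-Reasoning

injective⇒surjective : ∀ {n} (f : Fin n → Fin n) → (∀ {i j} → f i ≡ f j → i ≡ j) → ∀ y → ∃ λ x → f x ≡ y
injective⇒surjective {suc n} f f-inj y with FinP.any? (λ x → f x FinP.≟ y)
... | yes hit = hit
... | no miss = ⊥-elim collision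
  where
  y≢f : ∀ x → y ≢ f x
  y≢f x y≡fx = miss (x , sym y≡fx)
  collision : ⊥
  collision with FinP.pigeonhole (ℕP.n<1+n n) (λ x → Fin.punchOut (y≢f x))
  ... | i , j , i<j , same with f-inj (FinP.punchOut-injective (y≢f i) (y≢f j) same)
  ...   | refl = FinP.<-irrefl refl i<j

-- Pattern occurrences

StrictlyIncreasing : ∀ {k n} → (Fin k → Fin n) → Set
StrictlyIncreasing f = ∀ i j → i < j → f i < f j

strictlyIncreasing⇔ : ∀ {k n} {f : Fin k → Fin n} → StrictlyIncreasing f → ∀ i j → (f i < f j) ⇔ (i < j)
strictlyIncreasing⇔ {f = f} f↑ i j = mk⇔ reflect (f↑ i j)
  where
  reflect : f i < f j → i < j
  reflect fi<fj with FinP.<-cmp i j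
  ... | tri< i<j _    _   = i<j
  ... | tri≈ _   refl _   = ⊥-elim (FinP.<-irrefl refl fi<fj)
  ... | tri> _   _    j<i = ⊥-elim (FinP.<-asym fi<fj (f↑ j i j<i))

contains-by-embeddings : ∀ {k n} {π : Vec (Fin k) k} {τ : Vec (Fin n) n} (c h : Fin k → Fin n) →
                         StrictlyIncreasing c → StrictlyIncreasing h →
                         (∀ i → lookup τ (c i) ≡ h (lookup π i)) → Contains π τ
contains-by-embeddings {π = π} {τ} c h c↑ h↑ τ∘c≡h∘π = c , c↑ , isomorphic
  where
  isomorphic : ∀ i j → (lookup τ (c i) < lookup τ (c j)) ⇔ (lookup π i < lookup π j)
  isomorphic i j rewrite τ∘c≡h∘π i | τ∘c≡h∘π j = strictlyIncreasing⇔ h↑ (lookup π i) (lookup π j)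

triple-increasing : ∀ {n} {x y z : Fin n} → x < y → y < z → StrictlyIncreasing (lookup (x ∷ y ∷ z ∷ []))
triple-increasing x<y y<z 0F 1F _               = x<y
triple-increasing x<y y<z 0F 2F _               = FinP.<-trans x<y y<z
triple-increasing x<y y<z 1F 2F _               = y<z
triple-increasing x<y y<z 0F 0F ()
triple-increasing x<y y<z 1F 0F ()
triple-increasing x<y y<z 1F 1F (s<s ())
triple-increasing x<y y<z 2F 0F ()
triple-increasing x<y y<z 2F 1F (s<s ())
triple-increasing x<y y<z 2F 2F (s<s (s<s ()))

adjacent-trichotomy : ∀ {n} (i : Fin n) (k : Fin (suc n)) →
                      k < inject₁ i ⊎ k ≡ inject₁ i ⊎ k ≡ suc i ⊎ suc i < k
adjacent-trichotomy zero    zero          = inj₂ (inj₁ refl)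
adjacent-trichotomy zero    (suc zero)    = inj₂ (inj₂ (inj₁ refl))
adjacent-trichotomy zero    (suc (suc k)) = inj₂ (inj₂ (inj₂ (s<s z<s)))
adjacent-trichotomy (suc i) zero          = inj₁ z<s
adjacent-trichotomy (suc i) (suc k) with adjacent-trichotomy i k
... | inj₁ k<i                 = inj₁ (s<s k<i)
... | inj₂ (inj₁ refl)         = inj₂ (inj₁ refl)
... | inj₂ (inj₂ (inj₁ refl))  = inj₂ (inj₂ (inj₁ refl))
... | inj₂ (inj₂ (inj₂ i<k))   = inj₂ (inj₂ (inj₂ (s<s i<k)))

-- The values h list the three entries in increasing order, so that τ ∘ c = h ∘ π by computation.
module _ {n : ℕ} (τ : Vec (Fin n) n) {x y z : Fin n} (x<y : x < y) (y<z : y < z) where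

  occurrence-132 : lookup τ x < lookup τ z → lookup τ z < lookup τ y → Contains p132 τ
  occurrence-132 l r =
    contains-by-embeddings {π = p132} {τ} _ (lookup (lookup τ x ∷ lookup τ z ∷ lookup τ y ∷ []))
      (triple-increasing x<y y<z) (triple-increasing l r) λ { 0F → refl ; 1F → refl ; 2F → refl }

  occurrence-213 : lookup τ y < lookup τ x → lookup τ x < lookup τ z → Contains p213 τ
  occurrence-213 l r =
    contains-by-embeddings {π = p213} {τ} _ (lookup (lookup τ y ∷ lookup τ x ∷ lookup τ z ∷ []))
      (triple-increasing x<y y<z) (triple-increasing l r) λ { 0F → refl ; 1F → refl ; 2F → refl }

  occurrence-321 : lookup τ z < lookup τ y → lookup τ y < lookup τ x → Contains p321 τ
  occurrence-321 l r =
    contains-by-embeddings {π = p321} {τ} _ (lookup (lookup τ z ∷ lookup τ y ∷ lookup τ x ∷ []))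
      (triple-increasing x<y y<z) (triple-increasing l r) λ { 0F → refl ; 1F → refl ; 2F → refl }

-- Permutations shaped like a rotation

record RotationShape {n} (τ : Vec (Fin n) n) (c : ℕ) : Set where
  field
    ascending  : ∀ {i j} → i < j → toℕ j ℕ.< c ⊎ c ℕ.≤ toℕ i → lookup τ i < lookup τ j
    descending : ∀ {i j} → toℕ i ℕ.< c → c ℕ.≤ toℕ j → lookup τ j < lookup τ i

  ascends-or-straddles : ∀ {i j} → i < j → lookup τ i < lookup τ j ⊎ toℕ i ℕ.< c × c ℕ.≤ toℕ j
  ascends-or-straddles {i} {j} i<j with toℕ j ℕ.<? c | c ℕ.≤? toℕ i
  ... | yes j<c | _       = inj₁ (ascending i<j (inj₁ j<c))
  ... | no _    | yes c≤i = inj₁ (ascending i<j (inj₂ c≤i))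
  ... | no j≮c  | no c≰i  = inj₂ (ℕP.≰⇒> c≰i , ≮⇒≥ j≮c)

  inversion-straddles : ∀ {i j} → i < j → lookup τ j < lookup τ i → toℕ i ℕ.< c × c ℕ.≤ toℕ j
  inversion-straddles i<j τj<τi with ascends-or-straddles i<j
  ... | inj₁ τi<τj  = ⊥-elim (FinP.<-asym τj<τi τi<τj)
  ... | inj₂ across = across

  isPerm : IsPerm τ
  isPerm = injective⇒isPerm injective
    where
    distinct : ∀ {i j} → i < j → lookup τ i ≢ lookup τ j
    distinct i<j τi≡τj with ascends-or-straddles i<j
    ... | inj₁ τi<τj         = FinP.<-irrefl τi≡τj τi<τj
    ... | inj₂ (i<c , c≤j)   = FinP.<-irrefl (sym τi≡τj) (descending i<c c≤j)
    injective : ∀ {i j} → lookup τ i ≡ lookup τ j → i ≡ j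
    injective {i} {j} τi≡τj with FinP.<-cmp i j
    ... | tri< i<j _ _ = ⊥-elim (distinct i<j τi≡τj)
    ... | tri≈ _ i≡j _ = i≡j
    ... | tri> _ _ j<i = ⊥-elim (distinct j<i (sym τi≡τj))

  -- An occurrence of each pattern has an inversion, which fixes where c lies among its
  -- positions; then descending, or a second inversion, contradicts the pattern.
  avoids-132 : Avoids p132 τ
  avoids-132 (pos , pos↑ , iso) =
    let y<c , c≤z = inversion-straddles (pos↑ 1F 2F (s<s z<s)) (from (iso 2F 1F) (s<s z<s))
    in FinP.<-asym (from (iso 0F 2F) z<s) (descending (ℕP.<-trans (pos↑ 0F 1F z<s) y<c) c≤z)

  avoids-213 : Avoids p213 τ
  avoids-213 (pos , pos↑ , iso) =
    let x<c , c≤y = inversion-straddles (pos↑ 0F 1F z<s) (from (iso 1F 0F) z<s)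
        c≤z = ≤-trans c≤y (ℕP.<⇒≤ (pos↑ 1F 2F (s<s z<s)))
    in FinP.<-asym (from (iso 0F 2F) (s<s z<s)) (descending x<c c≤z)

  avoids-321 : Avoids p321 τ
  avoids-321 (pos , pos↑ , iso) =
    ℕP.<⇒≱ (proj₁ (inversion-straddles (pos↑ 1F 2F (s<s z<s)) (from (iso 2F 1F) z<s)))
           (proj₂ (inversion-straddles (pos↑ 0F 1F z<s) (from (iso 1F 0F) (s<s z<s))))

-- Rotations

[m%d+n]%d≡[m+n]%d : ∀ m n d .{{_ : NonZero d}} → (m % d + n) % d ≡ (m + n) % d
[m%d+n]%d≡[m+n]%d m n d = begin
  (m % d + n) % d         ≡⟨ %-distribˡ-+ (m % d) n d ⟩
  (m % d % d + n % d) % d ≡⟨ cong (λ a → (a + n % d) % d) (m%n%n≡m%n m d) ⟩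
  (m % d + n % d) % d     ≡⟨ %-distribˡ-+ m n d ⟨
  (m + n) % d             ∎
  where open ≡-Reasoning

[m+n%d]%d≡[m+n]%d : ∀ m n d .{{_ : NonZero d}} → (m + n % d) % d ≡ (m + n) % d
[m+n%d]%d≡[m+n]%d m n d = begin
  (m + n % d) % d ≡⟨ cong (_% d) (+-comm m (n % d)) ⟩
  (n % d + m) % d ≡⟨ [m%d+n]%d≡[m+n]%d n m d ⟩
  (n + m) % d     ≡⟨ cong (_% d) (+-comm n m) ⟩
  (m + n) % d     ∎
  where open ≡-Reasoning

module Rotations (n : ℕ) where

  N : ℕ
  N = suc n

  rotate : ℕ → Fin N → Fin N
  rotate s i = (toℕ i + s) mod N

  rotation : ℕ → Vec (Fin N) N
  rotation s = tabulate (rotate s)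

  toℕ-rotate : ∀ s i → toℕ (rotate s i) ≡ (toℕ i + s) % N
  toℕ-rotate s i = FinP.toℕ-fromℕ< _

  lookup-rotation : ∀ s i → lookup (rotation s) i ≡ rotate s i
  lookup-rotation s = lookup∘tabulate (rotate s)

  rotate-rotate : ∀ s t i → rotate t (rotate s i) ≡ rotate (s + t) i
  rotate-rotate s t i = FinP.toℕ-injective (begin
    toℕ (rotate t (rotate s i)) ≡⟨ toℕ-rotate t (rotate s i) ⟩
    (toℕ (rotate s i) + t) % N  ≡⟨ cong (λ a → (a + t) % N) (toℕ-rotate s i) ⟩
    ((toℕ i + s) % N + t) % N   ≡⟨ [m%d+n]%d≡[m+n]%d (toℕ i + s) t N ⟩
    (toℕ i + s + t) % N         ≡⟨ cong (_% N) (+-assoc (toℕ i) s t) ⟩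
    (toℕ i + (s + t)) % N       ≡⟨ toℕ-rotate (s + t) i ⟨
    toℕ (rotate (s + t) i)      ∎)
    where open ≡-Reasoning

  rotate-N : ∀ i → rotate N i ≡ i
  rotate-N i = FinP.toℕ-injective (begin
    toℕ (rotate N i) ≡⟨ toℕ-rotate N i ⟩
    (toℕ i + N) % N  ≡⟨ [m+n]%n≡m%n (toℕ i) N ⟩
    toℕ i % N        ≡⟨ m<n⇒m%n≡m (FinP.toℕ<n i) ⟩
    toℕ i            ∎)
    where open ≡-Reasoning

  rotate-mod : ∀ s i → rotate (s % N) i ≡ rotate s i
  rotate-mod s i = FinP.toℕ-injective (begin
    toℕ (rotate (s % N) i) ≡⟨ toℕ-rotate (s % N) i ⟩
    (toℕ i + s % N) % N    ≡⟨ [m+n%d]%d≡[m+n]%d (toℕ i) s N ⟩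
    (toℕ i + s) % N        ≡⟨ toℕ-rotate s i ⟨
    toℕ (rotate s i)       ∎)
    where open ≡-Reasoning

  rotate-cancel : ∀ {s} → s ℕ.≤ N → ∀ i → rotate s (rotate (N ∸ s) i) ≡ i
  rotate-cancel {s} s≤N i = begin
    rotate s (rotate (N ∸ s) i) ≡⟨ rotate-rotate (N ∸ s) s i ⟩
    rotate (N ∸ s + s) i        ≡⟨ cong (λ t → rotate t i) (m∸n+n≡m s≤N) ⟩
    rotate N i                  ≡⟨ rotate-N i ⟩
    i                           ∎
    where open ≡-Reasoning

  rotation-below : ∀ {s} → s ℕ.≤ N → ∀ i → toℕ i ℕ.< N ∸ s → toℕ (lookup (rotation s) i) ≡ toℕ i + s
  rotation-below {s} s≤N i i<c = begin
    toℕ (lookup (rotation s) i) ≡⟨ cong toℕ (lookup-rotation s i) ⟩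
    toℕ (rotate s i)            ≡⟨ toℕ-rotate s i ⟩
    (toℕ i + s) % N             ≡⟨ m<n⇒m%n≡m (m≤o∸n⇒m+n≤o (suc (toℕ i)) s≤N i<c) ⟩
    toℕ i + s                   ∎
    where open ≡-Reasoning

  rotation-from : ∀ {s} → s ℕ.≤ N → ∀ i → N ∸ s ℕ.≤ toℕ i →
                  toℕ (lookup (rotation s) i) ≡ toℕ i ∸ (N ∸ s)
  rotation-from {s} s≤N i c≤i = begin
    toℕ (lookup (rotation s) i) ≡⟨ cong toℕ (lookup-rotation s i) ⟩
    toℕ (rotate s i)            ≡⟨ toℕ-rotate s i ⟩
    (toℕ i + s) % N             ≡⟨ cong (λ a → (a + s) % N) (m∸n+n≡m c≤i) ⟨
    (toℕ i ∸ c + c + s) % N     ≡⟨ cong (_% N) (+-assoc (toℕ i ∸ c) c s) ⟩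
    (toℕ i ∸ c + (c + s)) % N   ≡⟨ cong (λ a → (toℕ i ∸ c + a) % N) (m∸n+n≡m s≤N) ⟩
    (toℕ i ∸ c + N) % N         ≡⟨ [m+n]%n≡m%n (toℕ i ∸ c) N ⟩
    (toℕ i ∸ c) % N             ≡⟨ m<n⇒m%n≡m (ℕP.≤-<-trans (ℕP.m∸n≤m (toℕ i) c) (FinP.toℕ<n i)) ⟩
    toℕ i ∸ c                   ∎
    where
    c : ℕ
    c = N ∸ s
    open ≡-Reasoning

  reduced-rotation-shape : ∀ {s} → s ℕ.< N → RotationShape (rotation s) (N ∸ s)
  reduced-rotation-shape {s} s<N = record { ascending = ascending ; descending = descending }
    where
    s≤N : s ℕ.≤ N
    s≤N = ℕP.<⇒≤ s<N
    open ℕP.≤-Reasoning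
    ascending : ∀ {i j} → i < j → toℕ j ℕ.< N ∸ s ⊎ N ∸ s ℕ.≤ toℕ i →
                lookup (rotation s) i < lookup (rotation s) j
    ascending {i} {j} i<j (inj₁ j<c) = begin-strict
      toℕ (lookup (rotation s) i) ≡⟨ rotation-below s≤N i (ℕP.<-trans i<j j<c) ⟩
      toℕ i + s                   <⟨ +-monoˡ-< s i<j ⟩
      toℕ j + s                   ≡⟨ rotation-below s≤N j j<c ⟨
      toℕ (lookup (rotation s) j) ∎
    ascending {i} {j} i<j (inj₂ c≤i) = begin-strict
      toℕ (lookup (rotation s) i) ≡⟨ rotation-from s≤N i c≤i ⟩
      toℕ i ∸ (N ∸ s)             <⟨ ∸-monoˡ-< i<j c≤i ⟩
      toℕ j ∸ (N ∸ s)             ≡⟨ rotation-from s≤N j (≤-trans c≤i (ℕP.<⇒≤ i<j)) ⟨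
      toℕ (lookup (rotation s) j) ∎
    descending : ∀ {i j} → toℕ i ℕ.< N ∸ s → N ∸ s ℕ.≤ toℕ j →
                 lookup (rotation s) j < lookup (rotation s) i
    descending {i} {j} i<c c≤j = begin-strict
      toℕ (lookup (rotation s) j) ≡⟨ rotation-from s≤N j c≤j ⟩
      toℕ j ∸ (N ∸ s)             <⟨ ∸-monoˡ-< (FinP.toℕ<n j) c≤j ⟩
      N ∸ (N ∸ s)                 ≡⟨ m∸[m∸n]≡n s≤N ⟩
      s                           ≤⟨ m≤n+m s (toℕ i) ⟩
      toℕ i + s                   ≡⟨ rotation-below s≤N i i<c ⟨
      toℕ (lookup (rotation s) i) ∎

  rotation-shape : ∀ s → RotationShape (rotation s) (N ∸ s % N)
  rotation-shape s = subst (λ τ → RotationShape τ (N ∸ s % N)) (tabulate-cong (rotate-mod s))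
                       (reduced-rotation-shape (m%n<n s N))

  inverse-rotation : ∀ {s} → s ℕ.≤ N → ∀ i → lookup (inverse (rotation s)) i ≡ rotate (N ∸ s) i
  inverse-rotation {s} s≤N i = begin
    lookup σ⁻¹ i                        ≡⟨ cong (lookup σ⁻¹) (rotate-cancel s≤N i) ⟨
    lookup σ⁻¹ (rotate s j)             ≡⟨ cong (lookup σ⁻¹) (lookup-rotation s j) ⟨
    lookup σ⁻¹ (lookup (rotation s) j)  ≡⟨ inverse-lookup (RotationShape.isPerm (rotation-shape s)) j ⟩
    j                                   ∎
    where
    σ⁻¹ : Vec (Fin N) N
    σ⁻¹ = inverse (rotation s)
    j : Fin N
    j = rotate (N ∸ s) i
    open ≡-Reasoning

  rotation-composite : ∀ {s} t → s ℕ.≤ N → compose∘inv (rotation t) (rotation s) ≡ rotation (N ∸ s + t)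
  rotation-composite {s} t s≤N = tabulate-cong λ i → begin
    lookup (rotation t) (lookup (inverse (rotation s)) i) ≡⟨ cong (lookup (rotation t)) (inverse-rotation s≤N i) ⟩
    lookup (rotation t) (rotate (N ∸ s) i)               ≡⟨ lookup-rotation t (rotate (N ∸ s) i) ⟩
    rotate t (rotate (N ∸ s) i)                          ≡⟨ rotate-rotate (N ∸ s) t i ⟩
    rotate (N ∸ s + t) i                                 ∎
    where open ≡-Reasoning

  rotation-pair-in-S2 : ∀ {s} t → s ℕ.≤ N → InS2-132-213-321 N (rotation s , rotation t)
  rotation-pair-in-S2 {s} t s≤N =
    isPerm (rotation-shape s) , isPerm (rotation-shape t) ,
    avoids3 {p132} avoids-132 , avoids3 {p213} avoids-213 , avoids3 {p321} avoids-321
    where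
    open RotationShape using (isPerm; avoids-132; avoids-213; avoids-321)
    avoids3 : ∀ {π : Vec (Fin 3) 3} → (∀ {τ : Vec (Fin N) N} {c} → RotationShape τ c → Avoids π τ) →
              Avoids3 π (rotation s , rotation t)
    avoids3 {π} avoids =
      avoids (rotation-shape s) , avoids (rotation-shape t) ,
      subst (Avoids π) (sym (rotation-composite t s≤N)) (avoids (rotation-shape (N ∸ s + t)))

  toℕ-rotation-zero : ∀ {s} → s ℕ.< N → toℕ (lookup (rotation s) zero) ≡ s
  toℕ-rotation-zero {s} s<N =
    trans (cong toℕ (lookup-rotation s zero)) (trans (toℕ-rotate s zero) (m<n⇒m%n≡m s<N))

  rotation-injective : ∀ {s t} → s ℕ.< N → t ℕ.< N → rotation s ≡ rotation t → s ≡ t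
  rotation-injective s<N t<N eq =
    trans (sym (toℕ-rotation-zero s<N)) (trans (cong (λ τ → toℕ (lookup τ zero)) eq) (toℕ-rotation-zero t<N))

  module _ {σ : Vec (Fin N) N} (σ! : IsPerm σ)
           (σ-132 : Avoids p132 σ) (σ-213 : Avoids p213 σ) (σ-321 : Avoids p321 σ) where

    value-position : ∀ {m} → m ℕ.< N → ∃ λ k → toℕ (lookup σ k) ≡ m
    value-position m<N =
      let k , σk≡m = injective⇒surjective (lookup σ) (isPerm-injective σ!) (fromℕ< m<N)
      in k , trans (cong toℕ σk≡m) (FinP.toℕ-fromℕ< m<N)

    module _ (i : Fin n) where

      p q : Fin N
      p = inject₁ i
      q = suc i

      p<q : p < q
      p<q = FinP.≤̄⇒inject₁< ℕP.≤-refl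

      no-value-inside-ascent : ∀ k → lookup σ p < lookup σ k → lookup σ k < lookup σ q → ⊥
      no-value-inside-ascent k l r with adjacent-trichotomy i k
      ... | inj₁ k<p                = σ-213 (occurrence-213 σ k<p p<q l r)
      ... | inj₂ (inj₁ refl)        = FinP.<-irrefl refl l
      ... | inj₂ (inj₂ (inj₁ refl)) = FinP.<-irrefl refl r
      ... | inj₂ (inj₂ (inj₂ q<k))  = σ-132 (occurrence-132 σ p<q q<k l r)

      no-value-below-descent : ∀ k → lookup σ k < lookup σ q → lookup σ q < lookup σ p → ⊥
      no-value-below-descent k l r with adjacent-trichotomy i k
      ... | inj₁ k<p                = σ-132 (occurrence-132 σ k<p p<q l r)
      ... | inj₂ (inj₁ refl)        = FinP.<-asym l r
      ... | inj₂ (inj₂ (inj₁ refl)) = FinP.<-irrefl refl l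
      ... | inj₂ (inj₂ (inj₂ q<k))  = σ-321 (occurrence-321 σ p<q q<k l r)

      no-value-above-descent : ∀ k → lookup σ q < lookup σ p → lookup σ p < lookup σ k → ⊥
      no-value-above-descent k l r with adjacent-trichotomy i k
      ... | inj₁ k<p                = σ-321 (occurrence-321 σ k<p p<q l r)
      ... | inj₂ (inj₁ refl)        = FinP.<-irrefl refl r
      ... | inj₂ (inj₂ (inj₁ refl)) = FinP.<-asym l r
      ... | inj₂ (inj₂ (inj₂ q<k))  = σ-213 (occurrence-213 σ p<q q<k l r)

      ascent-by-one : lookup σ p < lookup σ q → toℕ (lookup σ q) ≡ suc (toℕ (lookup σ p))
      ascent-by-one ascent = ≤-antisym (≮⇒≥ gap) ascent
        where
        gap : ¬ suc (toℕ (lookup σ p)) ℕ.< toℕ (lookup σ q)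
        gap gap<q with value-position (ℕP.<-trans gap<q (FinP.toℕ<n (lookup σ q)))
        ... | k , σk≡gap =
          no-value-inside-ascent k (ℕP.≤-reflexive (sym σk≡gap)) (subst (ℕ._< _) (sym σk≡gap) gap<q)

      descent-to-zero : lookup σ q < lookup σ p → toℕ (lookup σ q) ≡ 0
      descent-to-zero descent = n≤0⇒n≡0 (≮⇒≥ positive)
        where
        positive : ¬ 0 ℕ.< toℕ (lookup σ q)
        positive 0<q with value-position {0} z<s
        ... | k , σk≡0 = no-value-below-descent k (subst (ℕ._< _) (sym σk≡0) 0<q) descent

      descent-from-top : lookup σ q < lookup σ p → toℕ (lookup σ p) ≡ n
      descent-from-top descent = ≤-antisym (ℕ.s≤s⁻¹ (FinP.toℕ<n (lookup σ p))) (≮⇒≥ below-top)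
        where
        below-top : ¬ toℕ (lookup σ p) ℕ.< n
        below-top p<n with value-position {n} ℕP.≤-refl
        ... | k , σk≡n = no-value-above-descent k descent (subst (_ ℕ.<_) (sym σk≡n) p<n)

      adjacent-step : toℕ (lookup σ q) ≡ suc (toℕ (lookup σ p)) % N
      adjacent-step with FinP.<-cmp (lookup σ p) (lookup σ q)
      ... | tri< ascent _ _ =
        trans (ascent-by-one ascent)
              (sym (m<n⇒m%n≡m (subst (ℕ._< N) (ascent-by-one ascent) (FinP.toℕ<n (lookup σ q)))))
      ... | tri≈ _ σp≡σq _ = ⊥-elim (FinP.<⇒≢ p<q (isPerm-injective σ! σp≡σq))
      ... | tri> _ _ descent = begin
        toℕ (lookup σ q)           ≡⟨ descent-to-zero descent ⟩
        0                          ≡⟨ n%n≡0 N ⟨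
        N % N                      ≡⟨ cong (λ a → suc a % N) (descent-from-top descent) ⟨
        suc (toℕ (lookup σ p)) % N ∎
        where open ≡-Reasoning

    avoider-is-rotation : σ ≡ rotation (toℕ (lookup σ zero))
    avoider-is-rotation = begin
      σ                   ≡⟨ tabulate∘lookup σ ⟨
      tabulate (lookup σ) ≡⟨ tabulate-cong (λ i → FinP.toℕ-injective (trans (shifted i) (sym (toℕ-rotate s i)))) ⟩
      rotation s          ∎
      where
      s : ℕ
      s = toℕ (lookup σ zero)
      Shifted : Fin N → Set
      Shifted i = toℕ (lookup σ i) ≡ (toℕ i + s) % N
      step : ∀ i → Shifted (inject₁ i) → Shifted (suc i)
      step i shifted-i = begin
        toℕ (lookup σ (suc i))               ≡⟨ adjacent-step i ⟩
        suc (toℕ (lookup σ (inject₁ i))) % N ≡⟨ cong (λ a → suc a % N) shifted-i ⟩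
        suc ((toℕ (inject₁ i) + s) % N) % N  ≡⟨ [m+n%d]%d≡[m+n]%d 1 (toℕ (inject₁ i) + s) N ⟩
        suc (toℕ (inject₁ i) + s) % N        ≡⟨ cong (λ a → suc (a + s) % N) (FinP.toℕ-inject₁ i) ⟩
        suc (toℕ i + s) % N                  ∎
        where open ≡-Reasoning
      shifted : ∀ i → Shifted i
      shifted = <-weakInduction Shifted (sym (m<n⇒m%n≡m (FinP.toℕ<n (lookup σ zero)))) step
      open ≡-Reasoning

  rotation-pair : Fin N × Fin N → Vec (Fin N) N × Vec (Fin N) N
  rotation-pair (j , k) = rotation (toℕ j) , rotation (toℕ k)

  rotation-pair-injective : ∀ {jk jk′} → rotation-pair jk ≡ rotation-pair jk′ → jk ≡ jk′
  rotation-pair-injective {j , k} {j′ , k′} eq = ×-≡,≡→≡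
    ( FinP.toℕ-injective (rotation-injective (FinP.toℕ<n j) (FinP.toℕ<n j′) (cong proj₁ eq))
    , FinP.toℕ-injective (rotation-injective (FinP.toℕ<n k) (FinP.toℕ<n k′) (cong proj₂ eq)))

  S2⇔rotation-pair : ∀ x → InS2-132-213-321 N x ⇔ ∃ λ jk → x ≡ rotation-pair jk
  S2⇔rotation-pair (σ , σ′) = mk⇔ rotations in-S2
    where
    rotations : InS2-132-213-321 N (σ , σ′) → ∃ λ jk → (σ , σ′) ≡ rotation-pair jk
    rotations (σ! , σ′! , (σ-132 , σ′-132 , _) , (σ-213 , σ′-213 , _) , (σ-321 , σ′-321 , _)) =
      (lookup σ zero , lookup σ′ zero) ,
      ×-≡,≡→≡ (avoider-is-rotation σ! σ-132 σ-213 σ-321 , avoider-is-rotation σ′! σ′-132 σ′-213 σ′-321)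
    in-S2 : (∃ λ jk → (σ , σ′) ≡ rotation-pair jk) → InS2-132-213-321 N (σ , σ′)
    in-S2 ((j , k) , refl) = rotation-pair-in-S2 (toℕ k) (ℕP.<⇒≤ (FinP.toℕ<n j))

theorem4p2 : (n : ℕ) → HasCard (InS2-132-213-321 (suc n)) (suc n * suc n)
theorem4p2 n = HasCard-image₂ rotation-pair rotation-pair-injective S2⇔rotation-pair
  where open Rotations n
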